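{- Let $n$, $m$ and $t$ be positive integers with $m\le \left\lfloor \frac{n}{t+1}\right\rfloor$. Then $$p^{(t)}(n,m)=1+\sum_{k=m}^{\left\lfloor \frac{n}{t+1}\right\rfloor} p^{(t)}(n-k,k).$$
   Context: A partition of a positive integer $n$ is a finite sequence $\lambda=[\lambda_1,\ldots,\lambda_k]$ of positive integers with $\lambda_1\ge\cdots\ge\lambda_k$ and $\lambda_1+\cdots+\lambda_k=n$; we write $\lambda\vdash n$. For positive integers $n,m,t$, $p^{(t)}(n,m)$ denotes the number of partitions $\lambda\vdash n$ all of whose parts are at least $m$ and which satisfy $\lambda_1\ge t\cdot\lambda_2$. The one-part partition $[n]$ is considered to satisfy this condition, so it is counted whenever $n\ge m$. -}

module Defs where

open import Data.Nat using (ℕ; zero; suc; _+_; _*_; _∸_; _≤_; _≥_; _/_)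
open import Data.Nat.Properties using (_≤?_)
open import Data.List using (List; []; _∷_; length; filter; map; concatMap; upTo)
open import Data.Nat.ListAction using (sum)
open import Data.Unit using (⊤; tt)
open import Data.List.Relation.Unary.All using (All)
open import Data.List.Relation.Unary.Linked using (Linked)
open import Data.Product using (_×_)
open import Relation.Unary using (Decidable)
open import Relation.Nullary using (Dec; yes; no)
open import Relation.Nullary.Decidable using (_×-dec_)
import Data.List.Relation.Unary.All as All
import Data.List.Relation.Unary.Linked as Linked

-- All finite sequences of positive integers with sum n (compositions of n),
-- built by choosing the first part k ∈ {1..n}.  Termination by fuel = n.
compositionsAux : ℕ → ℕ → List (List ℕ)
compositionsAux zero    zero    = [] ∷ []
compositionsAux zero    (suc _) = []
compositionsAux (suc f) zero    = [] ∷ []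
compositionsAux (suc f) (suc n) =
  concatMap (λ i → map (suc i ∷_) (compositionsAux f (n ∸ i))) (upTo (suc n))

compositions : ℕ → List (List ℕ)
compositions n = compositionsAux n n

-- A partition of n: a non-increasing finite sequence of positive integers summing to n.
-- (Positivity and sum are guaranteed by membership in `compositions n`.)
NonIncreasing : List ℕ → Set
NonIncreasing = Linked (λ a b → b ≤ a)

nonIncreasing? : Decidable NonIncreasing
nonIncreasing? = Linked.linked? (λ a b → b ≤? a)

PartsAtLeast : ℕ → List ℕ → Set
PartsAtLeast m = All (m ≤_)

partsAtLeast? : (m : ℕ) → Decidable (PartsAtLeast m)
partsAtLeast? m = All.all? (m ≤?_)

TCond : ℕ → List ℕ → Set
TCond t (a ∷ b ∷ _) = t * b ≤ a
TCond t _           = ⊤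

tCond? : (t : ℕ) → Decidable (TCond t)
tCond? t []          = yes tt
tCond? t (a ∷ [])    = yes tt
tCond? t (a ∷ b ∷ _) = t * b ≤? a

Good : ℕ → ℕ → List ℕ → Set
Good m t λs = NonIncreasing λs × PartsAtLeast m λs × TCond t λs

good? : (m t : ℕ) → Decidable (Good m t)
good? m t λs = nonIncreasing? λs ×-dec (partsAtLeast? m λs ×-dec tCond? t λs)

-- p^{(t)}(n,m): number of partitions of n with all parts ≥ m and λ₁ ≥ t·λ₂
p : ℕ → ℕ → ℕ → ℕ
p t n m = length (filter (good? m t) (compositions n))

-- Σ_{k=a}^{b} f k  (empty, i.e. 0, when b < a)
sumFromTo : ℕ → ℕ → (ℕ → ℕ) → ℕ
sumFromTo a b f = sum (map (λ i → f (a + i)) (upTo (suc b ∸ a)))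

module Submission where

-- Idea: remove the smallest part.  A partition counted by p^{(t)}(n,m) is
-- either [n], or it has at least two parts and deleting its last (smallest)
-- part k leaves a partition of n ∸ k into parts ≥ k that still satisfies
-- λ₁ ≥ t·λ₂.  Conversely, appending k to such a partition λ is admissible
-- exactly when m ≤ k and t·k ≤ λ₁, and for a partition of n ∸ k the latter
-- amounts to k·(t+1) ≤ n, i.e. k ≤ ⌊n/(t+1)⌋.  As t ≥ 1 forces k < n, the
-- appended partitions are never [n].

open import Defs
open import Data.Nat using (ℕ; zero; suc; _+_; _*_; _∸_; _≤_; _<_; _/_; z≤n; s≤s; NonZero)
open import Data.Nat.Properties
open import Data.Nat.DivMod using (m/n*n≤m; m/n≤m; /-monoˡ-≤; m*n/n≡m)
open import Data.Nat.ListAction using (sum)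
open import Data.Nat.ListAction.Properties using (sum-++)
open import Data.List using (List; []; _∷_; [_]; _∷ʳ_; length; filter; map; concatMap; upTo; head; last; InitLast; initLast; _∷ʳ′_)
open import Data.List.Properties using (length-++; length-map; map-cong; map-∘; ∷-injectiveʳ; ∷ʳ-injectiveˡ; ++-conicalʳ)
open import Data.List.Relation.Unary.All using (All; []; _∷_)
import Data.List.Relation.Unary.All as All
import Data.List.Relation.Unary.All.Properties as AllP
open import Data.List.Relation.Unary.Any using (here; there)
open import Data.List.Relation.Unary.AllPairs using ([]; _∷_)
open import Data.List.Relation.Unary.Linked using (Linked; []; [-]; _∷_)
open import Data.List.Relation.Unary.Unique.Propositional using (Unique)
import Data.List.Relation.Unary.Unique.Propositional.Properties as Unique
open import Data.List.Relation.Binary.Disjoint.Propositional using (Disjoint)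
open import Data.List.Relation.Binary.BagAndSetEquality using (∼bag⇒↭)
open import Data.List.Relation.Binary.Permutation.Propositional.Properties using (↭-length)
open import Data.List.Membership.Propositional using (_∈_; _∉_; find; lose)
open import Data.List.Membership.Propositional.Properties
open import Data.List.Membership.Propositional.Properties.WithK using (unique∧set⇒bag)
open import Data.Maybe using (just)
open import Data.Maybe.Properties using (just-injective)
open import Data.Product using (Σ-syntax; _×_; _,_; proj₂)
open import Data.Unit using (tt)
open import Function using (_∘_; _⇔_; mk⇔; Equivalence)
open import Relation.Binary using (Transitive)
open import Relation.Nullary using (contradiction)
open import Relation.Binary.PropositionalEquality using (_≡_; refl; sym; trans; cong; subst; module ≡-Reasoning)

same-members⇒same-length : ∀ {A : Set} {xs ys : List A} → Unique xs → Unique ys →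
  (∀ {z} → z ∈ xs ⇔ z ∈ ys) → length xs ≡ length ys
same-members⇒same-length ux uy same = ↭-length (∼bag⇒↭ (unique∧set⇒bag ux uy same))

unique-concatMap : ∀ {A B C : Set} {f : A → List B} {xs : List A}
  (tag : B → C) (index : A → C) → (∀ {x y} → index x ≡ index y → x ≡ y) →
  (∀ {x z} → z ∈ f x → tag z ≡ index x) →
  Unique xs → (∀ x → Unique (f x)) → Unique (concatMap f xs)
unique-concatMap tag index injective tagged [] unique-f = []
unique-concatMap {f = f} {x ∷ xs} tag index injective tagged (x∉xs ∷ unique-xs) unique-f =
  Unique.++⁺ (unique-f x) (unique-concatMap tag index injective tagged unique-xs unique-f) disjoint
  where
  disjoint : Disjoint (f x) (concatMap f xs)
  disjoint (z∈fx , z∈rest) with y , y∈xs , z∈fy ← find (∈-concatMap⁻ f z∈rest) =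
    All.lookup x∉xs y∈xs (injective (trans (sym (tagged z∈fx)) (tagged z∈fy)))

length-concatMap : ∀ {A B : Set} (f : A → List B) (xs : List A) →
  length (concatMap f xs) ≡ sum (map (length ∘ f) xs)
length-concatMap f [] = refl
length-concatMap f (x ∷ xs) = trans (length-++ (f x)) (cong (length (f x) +_) (length-concatMap f xs))

sum-∷ʳ : ∀ ys k → sum (ys ∷ʳ k) ≡ sum ys + k
sum-∷ʳ ys k = trans (sum-++ ys [ k ]) (cong (sum ys +_) (+-identityʳ k))

≤-quotient⇔ : ∀ {k n} d .{{_ : NonZero d}} → k ≤ n / d ⇔ k * d ≤ n
≤-quotient⇔ {k} {n} d = mk⇔
  (λ k≤q → ≤-trans (*-monoˡ-≤ d k≤q) (m/n*n≤m n d))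
  (λ kd≤n → subst (_≤ n / d) (m*n/n≡m k d) (/-monoˡ-≤ d kd≤n))

range : ℕ → ℕ → List ℕ
range m N = map (m +_) (upTo (suc N ∸ m))

sumFromTo-range : ∀ m N f → sumFromTo m N f ≡ sum (map f (range m N))
sumFromTo-range m N f = cong sum (map-∘ (upTo (suc N ∸ m)))

range-unique : ∀ m N → Unique (range m N)
range-unique m N = Unique.map⁺ (+-cancelˡ-≡ m _ _) (Unique.upTo⁺ (suc N ∸ m))

∈-range⇔ : ∀ {m N k} → m ≤ suc N → k ∈ range m N ⇔ (m ≤ k × k ≤ N)
∈-range⇔ {m} {N} {k} m≤1+N = mk⇔ to from
  where
  to : k ∈ range m N → m ≤ k × k ≤ N
  to k∈ with i , i∈ , refl ← ∈-map⁻ (m +_) k∈ =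
    m≤m+n m i , ≤-pred (≤-trans (+-monoʳ-< m (∈-upTo⁻ i∈)) (≤-reflexive (m+[n∸m]≡n m≤1+N)))
  from : m ≤ k × k ≤ N → k ∈ range m N
  from (m≤k , k≤N) = subst (_∈ range m N) (m+[n∸m]≡n m≤k)
    (∈-map⁺ (m +_) (∈-upTo⁺ (∸-monoˡ-< (s≤s k≤N) m≤k)))

Positive : List ℕ → Set
Positive = All (1 ≤_)

startingWith : ℕ → ℕ → ℕ → List (List ℕ)
startingWith f n i = map (suc i ∷_) (compositionsAux f (n ∸ i))

compositions-sound : ∀ f n {xs} → xs ∈ compositionsAux f n → Positive xs × sum xs ≡ n
compositions-sound zero    zero    (here refl) = [] , refl
compositions-sound zero    zero    (there ())
compositions-sound zero    (suc n) ()
compositions-sound (suc f) zero    (here refl) = [] , refl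
compositions-sound (suc f) zero    (there ())
compositions-sound (suc f) (suc n) xs∈
  with i , i∈ , xs∈start ← find (∈-concatMap⁻ (startingWith f n) {xs = upTo (suc n)} xs∈)
  with ys , ys∈ , refl ← ∈-map⁻ (suc i ∷_) xs∈start
  with positive , sum≡ ← compositions-sound f (n ∸ i) ys∈ =
    s≤s z≤n ∷ positive , cong suc (trans (cong (i +_) sum≡) (m+[n∸m]≡n (≤-pred (∈-upTo⁻ i∈))))

compositions-complete : ∀ {f n} xs → n ≤ f → Positive xs → sum xs ≡ n → xs ∈ compositionsAux f n
compositions-complete {zero}  {zero}  []           _         _              refl = here refl
compositions-complete {suc f} {zero}  []           _         _              refl = here refl
compositions-complete                 (zero ∷ ys)  _         (() ∷ _)       _
compositions-complete {n = zero}      (suc i ∷ ys) _         _              ()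
compositions-complete {zero}  {suc n} (suc i ∷ ys) ()        _              _
compositions-complete {suc f} {suc n} (suc i ∷ ys) (s≤s n≤f) (_ ∷ positive) sum≡ =
  ∈-concatMap⁺ (startingWith f n) (lose i∈ (∈-map⁺ (suc i ∷_) ys∈))
  where
  i+rest≡n : i + sum ys ≡ n
  i+rest≡n = suc-injective sum≡
  i∈ : i ∈ upTo (suc n)
  i∈ = ∈-upTo⁺ (s≤s (subst (i ≤_) i+rest≡n (m≤m+n i (sum ys))))
  ys∈ : ys ∈ compositionsAux f (n ∸ i)
  ys∈ = compositions-complete ys (≤-trans (m∸n≤m n i) n≤f) positive
          (trans (sym (m+n∸m≡n i (sum ys))) (cong (_∸ i) i+rest≡n))

compositions-unique : ∀ f n → Unique (compositionsAux f n)
compositions-unique zero    zero    = [] ∷ []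
compositions-unique zero    (suc n) = []
compositions-unique (suc f) zero    = [] ∷ []
compositions-unique (suc f) (suc n) =
  unique-concatMap head (just ∘ suc) (suc-injective ∘ just-injective) tagged
    (Unique.upTo⁺ (suc n)) (λ i → Unique.map⁺ ∷-injectiveʳ (compositions-unique f (n ∸ i)))
  where
  tagged : ∀ {i z} → z ∈ startingWith f n i → head z ≡ just (suc i)
  tagged {i} z∈ with _ , _ , refl ← ∈-map⁻ (suc i ∷_) z∈ = refl

partitions : ℕ → ℕ → ℕ → List (List ℕ)
partitions t n m = filter (good? m t) (compositions n)

partitions-unique : ∀ t n m → Unique (partitions t n m)
partitions-unique t n m = Unique.filter⁺ (good? m t) (compositions-unique n n)

-- When the minimal part size m is positive, positivity of the parts is
-- implied, so membership is just "sum n and Good".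
∈-partitions⇔ : ∀ {t n m xs} → 1 ≤ m → xs ∈ partitions t n m ⇔ (sum xs ≡ n × Good m t xs)
∈-partitions⇔ {t} {n} {m} {xs} 1≤m = mk⇔ to from
  where
  to : xs ∈ partitions t n m → sum xs ≡ n × Good m t xs
  to xs∈ with xs∈compositions , good ← ∈-filter⁻ (good? m t) xs∈ =
    proj₂ (compositions-sound n n xs∈compositions) , good
  from : sum xs ≡ n × Good m t xs → xs ∈ partitions t n m
  from (sum≡ , good@(_ , parts≥m , _)) =
    ∈-filter⁺ (good? m t) (compositions-complete xs ≤-refl (All.map (≤-trans 1≤m) parts≥m) sum≡) good

linked-∷ʳ⁺ : ∀ {R : ℕ → ℕ → Set} {ys k} → Linked R ys → All (λ y → R y k) ys → Linked R (ys ∷ʳ k)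
linked-∷ʳ⁺ []         []       = [-]
linked-∷ʳ⁺ [-]        (r ∷ []) = r ∷ [-]
linked-∷ʳ⁺ (r ∷ rest) (_ ∷ rs) = r ∷ linked-∷ʳ⁺ rest rs

linked-∷ʳ⁻ : ∀ {R : ℕ → ℕ → Set} {k} → Transitive R → ∀ ys →
  Linked R (ys ∷ʳ k) → Linked R ys × All (λ y → R y k) ys
linked-∷ʳ⁻ trans-R []           _          = [] , []
linked-∷ʳ⁻ trans-R (x ∷ [])     (r ∷ [-])  = [-] , r ∷ []
linked-∷ʳ⁻ trans-R (x ∷ y ∷ zs) (r ∷ rest) with chain , ryk ∷ rs ← linked-∷ʳ⁻ trans-R (y ∷ zs) rest =
  r ∷ chain , trans-R r ryk ∷ ryk ∷ rs

≥-trans : Transitive (λ (a b : ℕ) → b ≤ a)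
≥-trans b≤a c≤b = ≤-trans c≤b b≤a

tCond-∷ʳ⁺ : ∀ {t k} a ys → TCond t (a ∷ ys) → t * k ≤ a → TCond t ((a ∷ ys) ∷ʳ k)
tCond-∷ʳ⁺ a []      _  tk≤a = tk≤a
tCond-∷ʳ⁺ a (b ∷ _) tc _    = tc

tCond-∷ʳ⁻ : ∀ {t k} a ys → All (k ≤_) (a ∷ ys) → TCond t ((a ∷ ys) ∷ʳ k) → TCond t (a ∷ ys) × t * k ≤ a
tCond-∷ʳ⁻     a []      _               tk≤a = tt , tk≤a
tCond-∷ʳ⁻ {t} a (b ∷ _) (_ ∷ k≤b ∷ _)   tb≤a = tb≤a , ≤-trans (*-monoʳ-≤ t k≤b) tb≤a

good-∷ʳ⁺ : ∀ {m t k a ys} → m ≤ k → Good k t (a ∷ ys) → t * k ≤ a → Good m t ((a ∷ ys) ∷ʳ k)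
good-∷ʳ⁺ {a = a} {ys} m≤k (chain , parts≥k , tc) tk≤a =
  linked-∷ʳ⁺ chain parts≥k ,
  AllP.∷ʳ⁺ (All.map (≤-trans m≤k) parts≥k) m≤k ,
  tCond-∷ʳ⁺ a ys tc tk≤a

good-∷ʳ⁻ : ∀ {m t k a ys} → Good m t ((a ∷ ys) ∷ʳ k) → m ≤ k × Good k t (a ∷ ys) × t * k ≤ a
good-∷ʳ⁻ {k = k} {a} {ys} (chain , parts≥m , tc)
  with chain′ , parts≥k ← linked-∷ʳ⁻ {k = k} ≥-trans (a ∷ ys) chain
  with tc′ , tk≤a ← tCond-∷ʳ⁻ a ys parts≥k tc =
    proj₂ (AllP.∷ʳ⁻ {xs = a ∷ ys} parts≥m) , (chain′ , parts≥k , tc′) , tk≤a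

head-bound⇒≤quotient : ∀ {t n k a ys} → sum (a ∷ ys) + k ≡ n → t * k ≤ a → k ≤ n / suc t
head-bound⇒≤quotient {t} {n} {k} {a} {ys} total tk≤a =
  Equivalence.from (≤-quotient⇔ (suc t)) (begin
    k * suc t          ≡⟨ *-suc k t ⟩
    k + k * t          ≡⟨ cong (k +_) (*-comm k t) ⟩
    k + t * k          ≤⟨ +-monoʳ-≤ k (≤-trans tk≤a (m≤m+n a (sum ys))) ⟩
    k + sum (a ∷ ys)   ≡⟨ +-comm k (sum (a ∷ ys)) ⟩
    sum (a ∷ ys) + k   ≡⟨ total ⟩
    n                  ∎)
  where open ≤-Reasoning

≤quotient⇒head-bound : ∀ {t n k a ys} → sum (a ∷ ys) + k ≡ n → Good k t (a ∷ ys) →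
  k ≤ n / suc t → t * k ≤ a
≤quotient⇒head-bound {t} {n} {k} {a} {[]} total _ k≤q = +-cancelʳ-≤ k (t * k) a (begin
  t * k + k          ≡⟨ +-comm (t * k) k ⟩
  k + t * k          ≡⟨ cong (k +_) (*-comm t k) ⟩
  k + k * t          ≡⟨ *-suc k t ⟨
  k * suc t          ≤⟨ Equivalence.to (≤-quotient⇔ (suc t)) k≤q ⟩
  n                  ≡⟨ total ⟨
  a + 0 + k          ≡⟨ cong (_+ k) (+-identityʳ a) ⟩
  a + k              ∎)
  where open ≤-Reasoning
≤quotient⇒head-bound {t} {ys = b ∷ _} _ (_ , _ ∷ k≤b ∷ _ , tb≤a) _ = ≤-trans (*-monoʳ-≤ t k≤b) tb≤a

≤quotient⇒< : ∀ {t n k} → 1 ≤ t → 1 ≤ k → k ≤ n / suc t → k < n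
≤quotient⇒< {t} {n} {k} 1≤t 1≤k k≤q = begin-strict
  k                  <⟨ m<m+n k (*-mono-≤ 1≤k 1≤t) ⟩
  k + k * t          ≡⟨ *-suc k t ⟨
  k * suc t          ≤⟨ Equivalence.to (≤-quotient⇔ (suc t)) k≤q ⟩
  n                  ∎
  where open ≤-Reasoning

block : ℕ → ℕ → ℕ → List (List ℕ)
block t n k = map (_∷ʳ k) (partitions t (n ∸ k) k)

last-∷ʳ : ∀ (ys : List ℕ) k → last (ys ∷ʳ k) ≡ just k
last-∷ʳ []           k = refl
last-∷ʳ (y ∷ [])     k = refl
last-∷ʳ (y ∷ z ∷ ys) k = last-∷ʳ (z ∷ ys) k

module Decomposition (t n m : ℕ) (1≤n : 1 ≤ n) (1≤m : 1 ≤ m) (1≤t : 1 ≤ t) (m≤N : m ≤ n / suc t) where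

  N : ℕ
  N = n / suc t

  decomposition : List (List ℕ)
  decomposition = [ n ] ∷ concatMap (block t n) (range m N)

  ∈-range⇔′ : ∀ {k} → k ∈ range m N ⇔ (m ≤ k × k ≤ N)
  ∈-range⇔′ = ∈-range⇔ (m≤n⇒m≤1+n m≤N)

  remove-last : ∀ {a ys k} → sum ((a ∷ ys) ∷ʳ k) ≡ n → Good m t ((a ∷ ys) ∷ʳ k) →
    (m ≤ k × k ≤ N) × (sum (a ∷ ys) ≡ n ∸ k × Good k t (a ∷ ys))
  remove-last {a} {ys} {k} sum≡ good with m≤k , good′ , tk≤a ← good-∷ʳ⁻ {k = k} {a} {ys} good =
    (m≤k , head-bound⇒≤quotient {ys = ys} total tk≤a) , (rest≡ , good′)
    where
    total : sum (a ∷ ys) + k ≡ n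
    total = trans (sym (sum-∷ʳ (a ∷ ys) k)) sum≡
    rest≡ : sum (a ∷ ys) ≡ n ∸ k
    rest≡ = trans (sym (m+n∸n≡m (sum (a ∷ ys)) k)) (cong (_∸ k) total)

  append-last : ∀ {a ys k} → m ≤ k → k ≤ N → sum (a ∷ ys) ≡ n ∸ k → Good k t (a ∷ ys) →
    sum ((a ∷ ys) ∷ʳ k) ≡ n × Good m t ((a ∷ ys) ∷ʳ k)
  append-last {a} {ys} {k} m≤k k≤N rest≡ good =
    trans (sum-∷ʳ (a ∷ ys) k) total , good-∷ʳ⁺ m≤k good (≤quotient⇒head-bound total good k≤N)
    where
    total : sum (a ∷ ys) + k ≡ n
    total = trans (cong (_+ k) rest≡) (m∸n+n≡m (≤-trans k≤N (m/n≤m n (suc t))))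

  -- Members of the blocks are (a ∷ ys) ∷ʳ k with a ∷ ys counted by p t (n ∸ k) k;
  -- the remaining part is nonempty because k < n.
  ∈-blocks⇒ : ∀ {z} → z ∈ concatMap (block t n) (range m N) →
    Σ[ k ∈ ℕ ] Σ[ a ∈ ℕ ] Σ[ ys ∈ List ℕ ]
      z ≡ (a ∷ ys) ∷ʳ k × (m ≤ k × k ≤ N) × (sum (a ∷ ys) ≡ n ∸ k × Good k t (a ∷ ys))
  ∈-blocks⇒ z∈
    with k , k∈ , z∈block ← find (∈-concatMap⁻ (block t n) z∈)
    with ys , ys∈ , refl ← ∈-map⁻ (_∷ʳ _) z∈block
    with m≤k , k≤N ← Equivalence.to ∈-range⇔′ k∈ =
      k , nonempty ys (Equivalence.to (∈-partitions⇔ (≤-trans 1≤m m≤k)) ys∈)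
    where
    nonempty : ∀ ys → sum ys ≡ n ∸ k × Good k t ys →
      Σ[ a ∈ ℕ ] Σ[ ys′ ∈ List ℕ ] ys ∷ʳ k ≡ (a ∷ ys′) ∷ʳ k × (m ≤ k × k ≤ N) × (sum (a ∷ ys′) ≡ n ∸ k × Good k t (a ∷ ys′))
    nonempty []        (0≡n∸k , _) = contradiction (sym 0≡n∸k) (m>n⇒m∸n≢0 (≤quotient⇒< 1≤t (≤-trans 1≤m m≤k) k≤N))
    nonempty (a ∷ ys′) partition   = a , ys′ , refl , (m≤k , k≤N) , partition

  partition⇒∈decomposition : ∀ {z} → InitLast z → sum z ≡ n × Good m t z → z ∈ decomposition
  partition⇒∈decomposition []               (sum≡ , _) = contradiction (sym sum≡) (m>n⇒m∸n≢0 {n} {0} 1≤n)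
  partition⇒∈decomposition ([] ∷ʳ′ k)       (sum≡ , _) = here (cong [_] (trans (sym (+-identityʳ k)) sum≡))
  partition⇒∈decomposition ((a ∷ ys) ∷ʳ′ k) (sum≡ , good)
    with range-bounds@(m≤k , _) , rest ← remove-last sum≡ good =
      there (∈-concatMap⁺ (block t n)
        (lose (Equivalence.from ∈-range⇔′ range-bounds)
              (∈-map⁺ (_∷ʳ k) (Equivalence.from (∈-partitions⇔ (≤-trans 1≤m m≤k)) rest))))

  ∈-decomposition⇔ : ∀ {z} → z ∈ partitions t n m ⇔ z ∈ decomposition
  ∈-decomposition⇔ {z} = mk⇔ to from
    where
    to : z ∈ partitions t n m → z ∈ decomposition
    to z∈ = partition⇒∈decomposition (initLast z) (Equivalence.to (∈-partitions⇔ 1≤m) z∈)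
    from : z ∈ decomposition → z ∈ partitions t n m
    from (here refl) = Equivalence.from (∈-partitions⇔ 1≤m)
      (+-identityʳ n , [-] , ≤-trans m≤N (m/n≤m n (suc t)) ∷ [] , tt)
    from (there z∈) with k , a , ys , refl , (m≤k , k≤N) , (rest≡ , good) ← ∈-blocks⇒ z∈ =
      Equivalence.from (∈-partitions⇔ 1≤m) (append-last m≤k k≤N rest≡ good)

  decomposition-unique : Unique decomposition
  decomposition-unique =
    AllP.¬Any⇒All¬ _ n∉blocks ∷
    unique-concatMap last just just-injective tagged (range-unique m N)
      (λ k → Unique.map⁺ (∷ʳ-injectiveˡ _ _) (partitions-unique t (n ∸ k) k))
    where
    tagged : ∀ {k z} → z ∈ block t n k → last z ≡ just k
    tagged {k} z∈ with ys , _ , refl ← ∈-map⁻ (_∷ʳ k) z∈ = last-∷ʳ ys k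
    n∉blocks : [ n ] ∉ concatMap (block t n) (range m N)
    n∉blocks n∈ with _ , _ , ys , [n]≡ , _ ← ∈-blocks⇒ n∈
      with () ← ++-conicalʳ ys [ _ ] (sym (∷-injectiveʳ [n]≡))

  length-decomposition : length decomposition ≡ 1 + sumFromTo m N (λ k → p t (n ∸ k) k)
  length-decomposition = cong suc (begin
    length (concatMap (block t n) (range m N))         ≡⟨ length-concatMap (block t n) (range m N) ⟩
    sum (map (length ∘ block t n) (range m N))         ≡⟨ cong sum (map-cong block-length (range m N)) ⟩
    sum (map (λ k → p t (n ∸ k) k) (range m N))        ≡⟨ sumFromTo-range m N (λ k → p t (n ∸ k) k) ⟨
    sumFromTo m N (λ k → p t (n ∸ k) k)                ∎)
    where
    open ≡-Reasoning
    block-length : ∀ k → length (block t n k) ≡ p t (n ∸ k) k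
    block-length k = length-map (_∷ʳ k) (partitions t (n ∸ k) k)

theorem2 : (n m t : ℕ) → 1 ≤ n → 1 ≤ m → 1 ≤ t → m ≤ n / suc t →
    p t n m ≡ 1 + sumFromTo m (n / suc t) (λ k → p t (n ∸ k) k)
theorem2 n m t 1≤n 1≤m 1≤t m≤N = begin
  p t n m                                            ≡⟨ same-members⇒same-length
                                                          (partitions-unique t n m) decomposition-unique ∈-decomposition⇔ ⟩
  length decomposition                               ≡⟨ length-decomposition ⟩
  1 + sumFromTo m (n / suc t) (λ k → p t (n ∸ k) k)  ∎
  where
  open ≡-Reasoning
  open Decomposition t n m 1≤n 1≤m 1≤t m≤N
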